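{- Let $T$ be an axiomatically appropriate theory. For any formula $A$, there exists a ground term $t$ such that if $T\vdash_{\mathsf{SE}} A$ then $T\vdash_{\mathsf{SE}} t:A$.
   Context: Syntax of $\mathsf{SE}$. There are countably infinite sets of justification constants $\mathsf{JConst}=\{0,1,c_1,c_2,\dots\}$ and justification variables $\mathsf{JVar}$. Terms: constants, variables, and $s\cdot t$, $s+t$ for terms $s,t$; a ground term is one containing no variables. Formulas: $\bot$, atomic propositions $P\in\mathsf{Prop}$, $A\to B$, and $t:A$; $\neg,\wedge,\vee,\leftrightarrow$ are abbreviations. $A[w/t]$ is simultaneous replacement of the variable $w$ by term $t$. Axioms of $\mathsf{SE}$ (for arbitrary formulas $A,B$ and variables $w,x,y,z$): (CL) propositional tautologies; (j) $x:(A\to B)\to(y:A\to x\cdot y:B)$; (j+) $x:A\wedge y:A\to(x+y):A$; (a+) $A[w/(x+y)+z]\to A[w/x+(y+z)]$; (c+) $A[w/x+y]\to A[w/y+x]$; (0+) $A[w/x+0]\leftrightarrow A[w/x]$; (am) $A[w/(x\cdot y)\cdot z]\leftrightarrow A[w/x\cdot(y\cdot z)]$; (a0) $A[w/x\cdot 0]\leftrightarrow A[w/0]$, $A[w/0\cdot x]\leftrightarrow A[w/0]$; (a1) $A[w/x\cdot 1]\leftrightarrow A[w/x]$, $A[w/1\cdot x]\leftrightarrow A[w/x]$; (dl) $A[w/x\cdot(y+z)]\leftrightarrow A[w/x\cdot y+x\cdot z]$; (dr) $A[w/(y+z)\cdot x]\leftrightarrow A[w/y\cdot x+z\cdot x]$.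 Rules: modus ponens and (jv): from $A$ infer $A[x/t]$. A theory is a set $T$ of formulas; $T\vdash_{\mathsf{SE}}F$ means $F$ is derivable from axioms and members of $T$ by these rules. $T$ is axiomatically appropriate if for every axiom $A$ there is a constant $c$ with $c:A\in T$, and for every $B\in T$ there is a constant $c$ with $c:B\in T$. -}

module Defs where

open import Data.Nat using (ℕ; _≟_)
open import Data.Bool using (Bool; true; false; not; _∨_)
open import Data.Product using (Σ; ∃; _×_; _,_)
open import Data.Empty using (⊥)
open import Data.Unit using (⊤)
open import Relation.Nullary using (yes; no)
open import Relation.Binary.PropositionalEquality using (_≡_)

data JConst : Set where
  c0 : JConst
  c1 : JConst
  c  : ℕ → JConst          -- c n stands for c_{n+1}

JVar : Set
JVar = ℕ

PropVar : Set
PropVar = ℕ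

infixl 7 _·_
infixl 6 _⊕_
data Term : Set where
  con : JConst → Term
  var : JVar → Term
  _·_ : Term → Term → Term
  _⊕_ : Term → Term → Term

zeroT oneT : Term
zeroT = con c0
oneT  = con c1

Ground : Term → Set
Ground (con _) = ⊤
Ground (var _) = ⊥
Ground (s · t) = Ground s × Ground t
Ground (s ⊕ t) = Ground s × Ground t

infixr 4 _⇒_
infix 5 _∶_
data Formula : Set where
  fls : Formula
  atom : PropVar → Formula
  _⇒_ : Formula → Formula → Formula
  _∶_ : Term → Formula → Formula

¬f : Formula → Formula
¬f A = A ⇒ fls

_∧f_ _∨f_ _⇔f_ : Formula → Formula → Formula
A ∧f B = ¬f (A ⇒ ¬f B)
A ∨f B = ¬f A ⇒ B
A ⇔f B = (A ⇒ B) ∧f (B ⇒ A)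

substT : JVar → Term → Term → Term
substT w t (con k) = con k
substT w t (var x) with x ≟ w
... | yes _ = t
... | no  _ = var x
substT w t (s₁ · s₂) = substT w t s₁ · substT w t s₂
substT w t (s₁ ⊕ s₂) = substT w t s₁ ⊕ substT w t s₂

_[_/_] : Formula → JVar → Term → Formula
fls [ w / t ] = fls
atom P [ w / t ] = atom P
(A ⇒ B) [ w / t ] = (A [ w / t ]) ⇒ (B [ w / t ])
(s ∶ A) [ w / t ] = substT w t s ∶ (A [ w / t ])

-- propositional evaluation: atoms and justification formulas t:A are treated
-- as propositional atoms, valued by v
eval : (Formula → Bool) → Formula → Bool
eval v fls = false
eval v (atom P) = v (atom P)
eval v (A ⇒ B) = not (eval v A) ∨ eval v B
eval v (s ∶ A) = v (s ∶ A)

Tautology : Formula → Set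
Tautology A = ∀ (v : Formula → Bool) → eval v A ≡ true

data Axiom : Formula → Set where
  CL  : ∀ {A} → Tautology A → Axiom A
  axj : ∀ A B x y → Axiom ((var x ∶ (A ⇒ B)) ⇒ ((var y ∶ A) ⇒ (var x · var y ∶ B)))
  axj+ : ∀ A x y → Axiom (((var x ∶ A) ∧f (var y ∶ A)) ⇒ (var x ⊕ var y ∶ A))
  a+  : ∀ A w x y z →
        Axiom ((A [ w / (var x ⊕ var y) ⊕ var z ]) ⇒ (A [ w / var x ⊕ (var y ⊕ var z) ]))
  c+  : ∀ A w x y → Axiom ((A [ w / var x ⊕ var y ]) ⇒ (A [ w / var y ⊕ var x ]))
  0+  : ∀ A w x → Axiom ((A [ w / var x ⊕ zeroT ]) ⇔f (A [ w / var x ]))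
  am  : ∀ A w x y z →
        Axiom ((A [ w / (var x · var y) · var z ]) ⇔f (A [ w / var x · (var y · var z) ]))
  a0r : ∀ A w x → Axiom ((A [ w / var x · zeroT ]) ⇔f (A [ w / zeroT ]))
  a0l : ∀ A w x → Axiom ((A [ w / zeroT · var x ]) ⇔f (A [ w / zeroT ]))
  a1r : ∀ A w x → Axiom ((A [ w / var x · oneT ]) ⇔f (A [ w / var x ]))
  a1l : ∀ A w x → Axiom ((A [ w / oneT · var x ]) ⇔f (A [ w / var x ]))
  dl  : ∀ A w x y z →
        Axiom ((A [ w / var x · (var y ⊕ var z) ]) ⇔f (A [ w / var x · var y ⊕ var x · var z ]))
  dr  : ∀ A w x y z →
        Axiom ((A [ w / (var y ⊕ var z) · var x ]) ⇔f (A [ w / var y · var x ⊕ var z · var x ]))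

Theory : Set₁
Theory = Formula → Set

infix 2 _⊢_
data _⊢_ (T : Theory) : Formula → Set where
  ax  : ∀ {A} → Axiom A → T ⊢ A
  hyp : ∀ {A} → T A → T ⊢ A
  mp  : ∀ {A B} → T ⊢ A ⇒ B → T ⊢ A → T ⊢ B
  jv  : ∀ {A} x t → T ⊢ A → T ⊢ A [ x / t ]

AxiomaticallyAppropriate : Theory → Set
AxiomaticallyAppropriate T =
  (∀ A → Axiom A → Σ JConst λ k → T (con k ∶ A)) ×
  (∀ B → T B → Σ JConst λ k → T (con k ∶ B))

{-# OPTIONS --safe #-}
-- Axioms and members of T are justified by the
-- constants that axiomatic appropriateness provides; for modus ponens the two
-- ground justifications are combined by an instance of (j), whose free variables
-- are instantiated with them by (jv); and an application of (jv) to t : A leaves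
-- the ground term t untouched, so it justifies the substituted formula as well.
module Submission where

open import Defs
open import Data.Product using (Σ; _×_; _,_)
open import Data.Nat using (ℕ; suc; _≤_; _⊔_; _≟_)
open import Data.Nat.Properties
  using (m⊔n≤o⇒m≤o; m⊔n≤o⇒n≤o; m≤m⊔n; m≤n⊔m; m≤n⇒m≤1+n; ≤-trans; n≮n; 1+n≢n)
open import Relation.Nullary using (yes; no)
open import Relation.Binary.PropositionalEquality
  using (_≡_; _≢_; refl; cong; cong₂; subst; trans)
open import Data.Empty using (⊥-elim)

varBoundᵀ : Term → ℕ
varBoundᵀ (con _) = 0
varBoundᵀ (var x) = suc x
varBoundᵀ (s · t) = varBoundᵀ s ⊔ varBoundᵀ t
varBoundᵀ (s ⊕ t) = varBoundᵀ s ⊔ varBoundᵀ t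

varBound : Formula → ℕ
varBound fls = 0
varBound (atom _) = 0
varBound (A ⇒ B) = varBound A ⊔ varBound B
varBound (s ∶ A) = varBoundᵀ s ⊔ varBound A

substT-self : ∀ x u → substT x u (var x) ≡ u
substT-self x u with x ≟ x
... | yes _ = refl
... | no x≢x = ⊥-elim (x≢x refl)

substT-other : ∀ x y u → y ≢ x → substT x u (var y) ≡ var y
substT-other x y u y≢x with y ≟ x
... | yes y≡x = ⊥-elim (y≢x y≡x)
... | no _ = refl

substT-fresh : ∀ x u s → varBoundᵀ s ≤ x → substT x u s ≡ s
substT-fresh x u (con _) _ = refl
substT-fresh x u (var y) y<x = substT-other x y u λ { refl → n≮n x y<x }
substT-fresh x u (s · t) b = cong₂ _·_ (substT-fresh x u s (m⊔n≤o⇒m≤o _ _ b))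
                                       (substT-fresh x u t (m⊔n≤o⇒n≤o _ _ b))
substT-fresh x u (s ⊕ t) b = cong₂ _⊕_ (substT-fresh x u s (m⊔n≤o⇒m≤o _ _ b))
                                       (substT-fresh x u t (m⊔n≤o⇒n≤o _ _ b))

subst-fresh : ∀ x u A → varBound A ≤ x → A [ x / u ] ≡ A
subst-fresh x u fls _ = refl
subst-fresh x u (atom _) _ = refl
subst-fresh x u (A ⇒ B) b = cong₂ _⇒_ (subst-fresh x u A (m⊔n≤o⇒m≤o _ _ b))
                                      (subst-fresh x u B (m⊔n≤o⇒n≤o _ _ b))
subst-fresh x u (s ∶ A) b = cong₂ _∶_ (substT-fresh x u s (m⊔n≤o⇒m≤o _ _ b))
                                      (subst-fresh x u A (m⊔n≤o⇒n≤o _ _ b))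

substT-ground : ∀ x u g → Ground g → substT x u g ≡ g
substT-ground x u (con _) _ = refl
substT-ground x u (s · t) (gs , gt) = cong₂ _·_ (substT-ground x u s gs) (substT-ground x u t gt)
substT-ground x u (s ⊕ t) (gs , gt) = cong₂ _⊕_ (substT-ground x u s gs) (substT-ground x u t gt)

⊢-application : ∀ {T} A B s t → T ⊢ (s ∶ (A ⇒ B)) ⇒ ((t ∶ A) ⇒ (s · t ∶ B))
⊢-application {T} A B s t =
  subst (T ⊢_) instance≡ (jv y t (jv x s (ax (axj A B x y))))
  where
  -- x and y = x + 1 are both fresh for A, B and s, so substituting s for x and
  -- then t for y affects only the two justification variables of (j).
  x y : ℕ
  x = varBound (A ⇒ B) ⊔ varBoundᵀ s
  y = suc x

  fresh : ∀ C → varBound C ≤ varBound (A ⇒ B) → (C [ x / s ]) [ y / t ] ≡ C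
  fresh C b = trans (cong (_[ y / t ]) (subst-fresh x s C x-bound))
                    (subst-fresh y t C (m≤n⇒m≤1+n x-bound))
    where
    x-bound : varBound C ≤ x
    x-bound = ≤-trans b (m≤m⊔n _ _)

  x↦s : substT y t (substT x s (var x)) ≡ s
  x↦s = trans (cong (substT y t) (substT-self x s))
              (substT-fresh y t s (m≤n⇒m≤1+n (m≤n⊔m _ _)))

  y↦t : substT y t (substT x s (var y)) ≡ t
  y↦t = trans (cong (substT y t) (substT-other x y s 1+n≢n))
              (substT-self y t)

  A≡ : (A [ x / s ]) [ y / t ] ≡ A
  A≡ = fresh A (m≤m⊔n _ _)
  B≡ : (B [ x / s ]) [ y / t ] ≡ B
  B≡ = fresh B (m≤n⊔m _ _)

  instance≡ : (((var x ∶ (A ⇒ B)) ⇒ ((var y ∶ A) ⇒ (var x · var y ∶ B))) [ x / s ]) [ y / t ]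
            ≡ ((s ∶ (A ⇒ B)) ⇒ ((t ∶ A) ⇒ (s · t ∶ B)))
  instance≡ = cong₂ _⇒_ (cong₂ _∶_ x↦s (cong₂ _⇒_ A≡ B≡))
                        (cong₂ _⇒_ (cong₂ _∶_ y↦t A≡) (cong₂ _∶_ (cong₂ _·_ x↦s y↦t) B≡))

mainTheorem7 : (T : Theory) → AxiomaticallyAppropriate T → (A : Formula) →
    T ⊢ A → Σ Term (λ t → Ground t × (T ⊢ t ∶ A))
mainTheorem7 T (axioms , members) A (ax a) with axioms A a
... | k , k∶A = con k , _ , hyp k∶A
mainTheorem7 T (axioms , members) A (hyp h) with members A h
... | k , k∶A = con k , _ , hyp k∶A
mainTheorem7 T app B (mp {A} ⊢A⇒B ⊢A)
  with mainTheorem7 T app (A ⇒ B) ⊢A⇒B | mainTheorem7 T app A ⊢A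
... | s , gs , s∶A⇒B | t , gt , t∶A =
  s · t , (gs , gt) , mp (mp (⊢-application A B s t) s∶A⇒B) t∶A
mainTheorem7 T app _ (jv {A} x u ⊢A) with mainTheorem7 T app A ⊢A
... | t , gt , t∶A =
  t , gt , subst (λ r → T ⊢ r ∶ (A [ x / u ])) (substT-ground x u t gt) (jv x u t∶A)
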